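{- Let $G$ be any simple finite graph with vertex set $\{v_1,\dots,v_n\}$ having an edge between vertices $v_i$ and $v_j$ ($i\neq j$). If a symmetric subgraph $J$ of $K_{n,n}$ contains the edges $(i,i')$, $(i,j')$ and $(j,i')$, then $\chi_\infty(G,J)=\infty$.
   Context: Let $K_{n,n}$ be the complete bipartite graph with parts $I_n=\{1,\dots,n\}$ and $I_n'=\{1',\dots,n'\}$; a subgraph $J$ of $K_{n,n}$ with vertex set $I_n\cup I_n'$ is symmetric if $i\sim j'$ iff $j\sim i'$. The self-similar graphs based on $(G,J)$: $G^1=G$; for $k\ge2$, $V(G^k)=V(G)^k$, and $(v_{i_1},\dots,v_{i_k})\sim(v_{j_1},\dots,v_{j_k})$ in $G^k$ iff either (1) $(v_{i_1},\dots,v_{i_{k-1}})=(v_{j_1},\dots,v_{j_{k-1}})$ and $v_{i_k}\sim v_{j_k}$ in $G$, or (2) $(v_{i_1},\dots,v_{i_{k-1}})\sim(v_{j_1},\dots,v_{j_{k-1}})$ in $G^{k-1}$ and $i_k\sim j_k'$ in $J$. The sequence $\chi(G^k)$ is non-decreasing; $\chi_\infty(G,J)$ denotes its limit, with $\chi_\infty(G,J)=\infty$ if it is unbounded. -}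

module Defs where

open import Level using (0ℓ)
open import Data.Nat using (ℕ; zero; suc)
open import Data.Fin using (Fin)
open import Data.Product using (_×_; _,_; ∃)
open import Data.Sum using (_⊎_)
open import Relation.Binary.PropositionalEquality using (_≡_; _≢_)
open import Relation.Nullary using (¬_)

record SimpleGraph (n : ℕ) : Set₁ where
  field
    Adj   : Fin n → Fin n → Set
    sym   : ∀ {i j} → Adj i j → Adj j i
    irrefl : ∀ {i} → ¬ Adj i i
open SimpleGraph public

-- A subgraph J of K_{n,n} on I_n ∪ I_n' is given by its edge relation:
-- BipEdge i j  means  i ~ j'  in J.
record BipSubgraph (n : ℕ) : Set₁ where
  field
    BipEdge : Fin n → Fin n → Set
open BipSubgraph public

Symmetric : ∀ {n} → BipSubgraph n → Set
Symmetric J = ∀ i j → (BipEdge J i j → BipEdge J j i) × (BipEdge J j i → BipEdge J i j)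

-- Self-similar graphs.  Index shift: SSVert/SSAdj at index k describe G^(k+1).
-- Vertices of G^1 are V(G); vertices of G^(k+1) are pairs
-- ((v_{i_1},...,v_{i_k}), v_{i_{k+1}}) i.e. V(G)^(k+1).
SSVert : ℕ → ℕ → Set
SSVert n zero    = Fin n
SSVert n (suc k) = SSVert n k × Fin n

SSAdj : ∀ {n} → SimpleGraph n → BipSubgraph n → (k : ℕ) → SSVert n k → SSVert n k → Set
SSAdj G J zero    a       b       = Adj G a b
SSAdj G J (suc k) (x , a) (y , b) =
  (x ≡ y × Adj G a b) ⊎ (SSAdj G J k x y × BipEdge J a b)

Colorable : (V : Set) → (V → V → Set) → ℕ → Set
Colorable V A c = ∃ λ (f : V → Fin c) → ∀ x y → A x y → f x ≢ f y

-- χ_∞(G,J) = ∞ : the sequence χ(G^k) is unbounded, i.e. for every c there is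
-- k ≥ 1 with χ(G^k) > c, i.e. G^k admits no proper c-colouring.
ChiInftyInfinite : ∀ {n} → SimpleGraph n → BipSubgraph n → Set
ChiInftyInfinite {n} G J =
  ∀ (c : ℕ) → ∃ λ (k : ℕ) → ¬ Colorable (SSVert n k) (SSAdj G J k) c

-- In G^(k+1) the k+1 words  w_m = i j^(k-m) i^m  (0 ≤ m ≤ k) are pairwise
-- adjacent: two distinct words either share their prefix of length k and end
-- in the G-edge {i, j}, or have adjacent prefixes and end in one of the
-- J-edges (i,i'), (i,j'), (j,i').  So χ(G^(k+1)) ≥ k+1, by the pigeonhole
-- principle.
module Submission where

open import Defs
open import Data.Nat using (ℕ; zero; suc)
open import Data.Nat.Properties using (n<1+n)
open import Data.Fin using (Fin; zero; suc)
open import Data.Fin.Properties using (pigeonhole; <⇒≢)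
open import Data.Product using (_,_; ∃)
open import Data.Sum using (inj₁; inj₂)
open import Relation.Binary.PropositionalEquality using (refl; cong; _≢_)
open import Relation.Nullary using (¬_; contradiction)

IsClique : {V : Set} → (V → V → Set) → {m : ℕ} → (Fin m → V) → Set
IsClique A w = ∀ p q → p ≢ q → A (w p) (w q)

clique⇒¬Colorable : ∀ {V A c} (w : Fin (suc c) → V) →
                    IsClique A w → ¬ Colorable V A c
clique⇒¬Colorable w clique (f , proper)
  with pigeonhole (n<1+n _) (λ p → f (w p))
... | p , q , p<q , same = proper (w p) (w q) (clique p q (<⇒≢ p<q)) same

module SelfSimilarClique {n} (G : SimpleGraph n) (J : BipSubgraph n)
         {i j : Fin n} (i~j : Adj G i j)
         (ii′ : BipEdge J i i) (ij′ : BipEdge J i j) (ji′ : BipEdge J j i) where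

  word : (k : ℕ) → Fin (suc k) → SSVert n k
  word zero    _       = i
  word (suc k) zero    = word k zero , j
  word (suc k) (suc m) = word k m , i

  word-isClique : ∀ k → IsClique (SSAdj G J k) (word k)
  word-isClique zero    zero          zero          p≢q = contradiction refl p≢q
  word-isClique (suc k) zero          zero          p≢q = contradiction refl p≢q
  word-isClique (suc k) zero          (suc zero)    _   = inj₁ (refl , SimpleGraph.sym G i~j)
  word-isClique (suc k) (suc zero)    zero          _   = inj₁ (refl , i~j)
  word-isClique (suc k) zero          (suc (suc m)) _   =
    inj₂ (word-isClique k zero (suc m) (λ ()) , ji′)
  word-isClique (suc k) (suc (suc m)) zero          _   =
    inj₂ (word-isClique k (suc m) zero (λ ()) , ij′)
  word-isClique (suc k) (suc p)       (suc q)       p≢q =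
    inj₂ (word-isClique k p q (λ p≡q → p≢q (cong suc p≡q)) , ii′)

theorem3p4 : (n : ℕ) (G : SimpleGraph n) (J : BipSubgraph n) → Symmetric J →
    (i j : Fin n) → Adj G i j →
    BipEdge J i i → BipEdge J i j → BipEdge J j i →
    ChiInftyInfinite G J
theorem3p4 n G J _ i j i~j ii′ ij′ ji′ c =
  c , clique⇒¬Colorable (word c) (word-isClique c)
  where open SelfSimilarClique G J i~j ii′ ij′ ji′
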